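{- Let $G=(V,A,s)$ be a flow graph with $n$ vertices, let $T$ be a spanning tree of $G$ rooted at $s$, and let the vertices be numbered $1,\dots,n$ in a bottom-up order of $T$ and identified with their numbers. Let $u$ and $v$ be distinct vertices such that $v\in \mathit{loop}(u)$ and $d(v)>u$. Then $d(v)=d(u)$.
   Context: A flow graph $G=(V,A,s)$ is a finite directed graph (parallel arcs and loop arcs allowed) with start vertex $s$ from which every vertex is reachable. A vertex $x$ dominates $y$ if every path from $s$ to $y$ contains $x$; every $y\neq s$ has a unique immediate dominator $d(y)\ne y$, a dominator of $y$ such that every dominator of $y$ other than $y$ dominates $d(y)$. $T$ is a spanning tree of $G$ rooted at $s$ with parent function $p$; a bottom-up order numbers the vertices with distinct integers $1,\dots,n$ so that $x<p(x)$ for all $x\ne s$. For a vertex $u$, $\mathit{loop}(u)$ is the set of all descendants $x$ of $u$ in $T$ (including $u$) such that there is a path in $G$ from $x$ to $u$ all of whose vertices are descendants of $u$ in $T$. -}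

module Defs where

open import Data.Nat using (ℕ; _<_)
open import Data.Fin using (Fin; toℕ)
open import Data.Product using (_×_; _,_; Σ)
open import Data.List using (List; []; _∷_)
open import Data.List.Membership.Propositional using (_∈_)
open import Data.List.Relation.Unary.All using (All)
open import Relation.Binary.PropositionalEquality using (_≡_; _≢_)

-- A finite directed graph on vertex set Fin n, given by its list of arcs
-- (x , y) meaning an arc x → y.  Parallel arcs (repeated entries) and
-- loops (x , x) are allowed.
Arcs : ℕ → Set
Arcs n = List (Fin n × Fin n)

data Path {n : ℕ} (A : Arcs n) : Fin n → Fin n → Set where
  [] : ∀ {x} → Path A x x
  _∷_ : ∀ {x y z} → (x , y) ∈ A → Path A y z → Path A x z

vertices : ∀ {n} {A : Arcs n} {x y : Fin n} → Path A x y → List (Fin n)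
vertices {x = x} [] = x ∷ []
vertices {x = x} (_ ∷ π) = x ∷ vertices π

record FlowGraph (n : ℕ) : Set where
  field
    arcs  : Arcs n
    start : Fin n
    reach : ∀ y → Path arcs start y

Dominates : ∀ {n} → FlowGraph n → Fin n → Fin n → Set
Dominates G x y = (π : Path (FlowGraph.arcs G) (FlowGraph.start G) y) → x ∈ vertices π

IsIdom : ∀ {n} → FlowGraph n → Fin n → Fin n → Set
IsIdom G x y =
  x ≢ y × Dominates G x y × (∀ z → Dominates G z y → z ≢ y → Dominates G z x)

-- Descendant relation of the tree given by a parent function p
-- (defined on all vertices other than the root s):
-- Desc p u x  means x is a descendant of u (including x = u).
data Desc {n : ℕ} {s : Fin n} (p : (x : Fin n) → x ≢ s → Fin n) (u : Fin n) : Fin n → Set where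
  here : Desc p u u
  up   : ∀ {x} (h : x ≢ s) → Desc p u (p x h) → Desc p u x

record SpanningTree {n : ℕ} (G : FlowGraph n) : Set where
  field
    parent    : (x : Fin n) → x ≢ FlowGraph.start G → Fin n
    parentArc : ∀ x (h : x ≢ FlowGraph.start G) → (parent x h , x) ∈ FlowGraph.arcs G
    rooted    : ∀ x → Desc parent (FlowGraph.start G) x

-- Vertices are identified with their numbers (toℕ); the order is
-- bottom-up for T: x < p(x) for every x ≠ s.
BottomUp : ∀ {n} {G : FlowGraph n} → SpanningTree G → Set
BottomUp {G = G} T =
  ∀ x (h : x ≢ FlowGraph.start G) → toℕ x < toℕ (SpanningTree.parent T x h)

-- x ∈ loop(u): x is a T-descendant of u and there is a path in G from
-- x to u all of whose vertices are T-descendants of u.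
InLoop : ∀ {n} {G : FlowGraph n} → SpanningTree G → Fin n → Fin n → Set
InLoop {G = G} T u x =
  Desc (SpanningTree.parent T) u x ×
  Σ (Path (FlowGraph.arcs G) x u) (λ π → All (Desc (SpanningTree.parent T) u) (vertices π))

-- Vertices of a tree path u ⇝ v and of a loop path v ⇝ u are
-- T-descendants of u, hence numbered at most u. Appending such a path to an
-- s-path shows that a dominator numbered above u of one endpoint dominates the
-- other: so d(v) dominates u, hence d(u); and since every dominator of u is a
-- T-ancestor of u, d(u) > u and d(u) dominates v, hence d(v). Dominance is
-- antisymmetric, so d(v) = d(u).
module Submission where

open import Defs
open import Data.Nat using (ℕ; suc; _<_; _≤_; z≤n; s≤s)
open import Data.Nat.Induction using (<-wellFounded)
open import Data.Nat.Properties using (≤-<-trans; <-≤-trans; <⇒≤; ≤-refl; ≤∧≢⇒<; ≤⇒≯; <⇒≢)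
open import Data.Fin using (Fin; toℕ)
open import Data.Fin.Properties using (toℕ-injective; _≟_)
open import Data.Product using (Σ; _,_; _×_; proj₁; proj₂)
open import Data.Sum using (_⊎_; inj₁; inj₂)
open import Data.Empty using (⊥; ⊥-elim)
open import Function using (_∘_)
open import Data.List.Membership.Propositional using (_∈_; _∉_)
open import Data.List.Relation.Unary.Any using (here; there)
open import Data.List.Relation.Unary.All as All using (All; []; _∷_)
open import Induction.WellFounded using (Acc; acc)
open import Relation.Nullary using (yes; no)
open import Relation.Binary.PropositionalEquality using (_≡_; _≢_; refl; sym; cong; subst)

module _ {n : ℕ} {A : Arcs n} where

  length : ∀ {x y} → Path A x y → ℕ
  length []      = 0
  length (_ ∷ π) = suc (length π)

  _++ᴾ_ : ∀ {x y z} → Path A x y → Path A y z → Path A x z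
  []      ++ᴾ ρ = ρ
  (e ∷ π) ++ᴾ ρ = e ∷ (π ++ᴾ ρ)

  ∈-++ᴾ⁻ : ∀ {x y z w} (π : Path A x y) (ρ : Path A y z) →
           w ∈ vertices (π ++ᴾ ρ) → w ∈ vertices π ⊎ w ∈ vertices ρ
  ∈-++ᴾ⁻ []      ρ w∈ρ        = inj₂ w∈ρ
  ∈-++ᴾ⁻ (e ∷ π) ρ (here w≡x) = inj₁ (here w≡x)
  ∈-++ᴾ⁻ (e ∷ π) ρ (there w∈) with ∈-++ᴾ⁻ π ρ w∈
  ... | inj₁ w∈π = inj₁ (there w∈π)
  ... | inj₂ w∈ρ = inj₂ w∈ρ

  All-++ᴾ⁺ : ∀ {x y z} {P : Fin n → Set} (π : Path A x y) (ρ : Path A y z) →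
             All P (vertices π) → All P (vertices ρ) → All P (vertices (π ++ᴾ ρ))
  All-++ᴾ⁺ []      ρ _          Pρ = Pρ
  All-++ᴾ⁺ (e ∷ π) ρ (Px ∷ Pπ) Pρ = Px ∷ All-++ᴾ⁺ π ρ Pπ Pρ

  truncate : ∀ {x z w} (π : Path A x z) → w ∈ vertices π → Path A x w
  truncate []      (here refl) = []
  truncate (e ∷ π) (here refl) = []
  truncate (e ∷ π) (there w∈π) = e ∷ truncate π w∈π

  length-truncate-≤ : ∀ {x z w} (π : Path A x z) (w∈π : w ∈ vertices π) →
                      length (truncate π w∈π) ≤ length π
  length-truncate-≤ []      (here refl) = z≤n
  length-truncate-≤ (e ∷ π) (here refl) = z≤n
  length-truncate-≤ (e ∷ π) (there w∈π) = s≤s (length-truncate-≤ π w∈π)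

  length-truncate-< : ∀ {x z w} (π : Path A x z) (w∈π : w ∈ vertices π) → w ≢ z →
                      length (truncate π w∈π) < length π
  length-truncate-< []      (here refl) w≢z = ⊥-elim (w≢z refl)
  length-truncate-< (e ∷ π) (here refl) w≢z = s≤s z≤n
  length-truncate-< (e ∷ π) (there w∈π) w≢z = s≤s (length-truncate-< π w∈π w≢z)

module _ {n : ℕ} (G : FlowGraph n) where
  open FlowGraph G

  dominates-backward : ∀ {x y z} → Dominates G x y →
                       (ρ : Path arcs z y) → x ∉ vertices ρ → Dominates G x z
  dominates-backward x-dom-y ρ x∉ρ π with ∈-++ᴾ⁻ π ρ (x-dom-y (π ++ᴾ ρ))
  ... | inj₁ x∈π = x∈π
  ... | inj₂ x∈ρ = ⊥-elim (x∉ρ x∈ρ)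

  -- If a ≠ b dominate each other, cutting a path s ⇝ a first at b and then
  -- at a gives a strictly shorter path s ⇝ a: an infinite descent.
  dominates-antisym : ∀ {a b} → Dominates G a b → Dominates G b a → a ≡ b
  dominates-antisym {a} {b} a-dom-b b-dom-a with a ≟ b
  ... | yes a≡b = a≡b
  ... | no  a≢b = ⊥-elim (descend (reach a) (<-wellFounded _))
    where
    descend : (π : Path arcs start a) → Acc _<_ (length π) → ⊥
    descend π (acc rec) = descend πa (rec shorter)
      where
      πb : Path arcs start b
      πb = truncate π (b-dom-a π)
      πa : Path arcs start a
      πa = truncate πb (a-dom-b πb)
      shorter : length πa < length π
      shorter = ≤-<-trans (length-truncate-≤ πb (a-dom-b πb))
                          (length-truncate-< π (b-dom-a π) (a≢b ∘ sym))

module _ {n : ℕ} {G : FlowGraph n} (T : SpanningTree G) where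
  open FlowGraph G
  open SpanningTree T

  treePath : ∀ {a x} → Desc parent a x →
             Σ (Path arcs a x) λ π → All (λ y → Desc parent a y × Desc parent y x) (vertices π)
  treePath here = [] , (here , here) ∷ []
  treePath {x = x} (up x≢s a⇝px) with treePath a⇝px
  ... | π , onπ = π ++ᴾ (parentArc x x≢s ∷ []) ,
                  All-++ᴾ⁺ π _ (All.map (λ { (a⇝y , y⇝px) → a⇝y , up x≢s y⇝px }) onπ)
                               ((a⇝px , up x≢s here) ∷ (up x≢s a⇝px , here) ∷ [])

  dominator-is-ancestor : ∀ {x y} → Dominates G x y → Desc parent x y
  dominator-is-ancestor {y = y} x-dom-y with treePath (rooted y)
  ... | π , onπ = proj₂ (All.lookup onπ (x-dom-y π))

  module _ (bottomUp : BottomUp T) where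

    Desc⇒≤ : ∀ {u x} → Desc parent u x → toℕ x ≤ toℕ u
    Desc⇒≤ here          = ≤-refl
    Desc⇒≤ (up x≢s u⇝px) = <⇒≤ (<-≤-trans (bottomUp _ x≢s) (Desc⇒≤ u⇝px))

    >⇒∉-descendants : ∀ {u x ws} → toℕ u < toℕ x → All (Desc parent u) ws → x ∉ ws
    >⇒∉-descendants u<x below-u x∈ws = ≤⇒≯ (Desc⇒≤ (All.lookup below-u x∈ws)) u<x

lemma9 : ∀ {n} (G : FlowGraph n) (T : SpanningTree G) → BottomUp T →
         ∀ u v → u ≢ v → InLoop T u v →
         ∀ dv du → IsIdom G dv v → IsIdom G du u →
         toℕ u < toℕ dv → dv ≡ du
lemma9 G T bottomUp u v _ (u⇝v , ρ , ρ-below-u) dv du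
       (_ , dv-dom-v , dv-idom) (du≢u , du-dom-u , du-idom) u<dv =
  dominates-antisym G dv-dom-du du-dom-dv
  where
  dv-dom-u : Dominates G dv u
  dv-dom-u with treePath T u⇝v
  ... | π , onπ = dominates-backward G dv-dom-v π
                    (>⇒∉-descendants T bottomUp u<dv (All.map proj₁ onπ))

  dv-dom-du : Dominates G dv du
  dv-dom-du = du-idom dv dv-dom-u (<⇒≢ u<dv ∘ sym ∘ cong toℕ)

  u<du : toℕ u < toℕ du
  u<du = ≤∧≢⇒< (Desc⇒≤ T bottomUp (dominator-is-ancestor T du-dom-u))
               (du≢u ∘ toℕ-injective ∘ sym)

  du-dom-v : Dominates G du v
  du-dom-v = dominates-backward G du-dom-u ρ (>⇒∉-descendants T bottomUp u<du ρ-below-u)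

  du≢v : du ≢ v
  du≢v du≡v = ≤⇒≯ (Desc⇒≤ T bottomUp u⇝v) (subst (λ w → toℕ u < toℕ w) du≡v u<du)

  du-dom-dv : Dominates G du dv
  du-dom-dv = dv-idom du du-dom-v du≢v
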